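{- Let $p\geq 3$ be a prime and let $n\geq 1$ be an integer. Let $K\subseteq \mathbb{F}_p$ be a fixed subset with $0\in K$, and set $t:=|K|$. Suppose that $A\subseteq (\mathbb{F}_p)^n$ is a subset such that $|A|> (p-t+1)^n$. Then there exist $\mathbf{a}_1,\mathbf{a}_2\in A$ with $\mathbf{a}_1\neq \mathbf{a}_2$ such that $\mathbf{a}_1-\mathbf{a}_2\in K^n$.
   Context: $\mathbb{F}_p$ denotes the field with $p$ elements, and $K^n=\{(k_1,\ldots,k_n): k_i\in K \text{ for all } i\}\subseteq (\mathbb{F}_p)^n$. -}

module Defs where

open import Data.Nat using (ℕ; suc; _+_; _∸_)
open import Data.Nat.DivMod using (_mod_)
open import Data.Fin using (Fin; toℕ; zero)
open import Data.Fin.Subset using (Subset; _∈_)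
open import Data.Vec using (Vec; zipWith)
open import Data.Vec.Relation.Unary.All using (All)

-- The field F_p is modelled by Fin p (residues 0..p-1) with arithmetic mod p.
-- Subtraction in F_p: a - b = (a + (p - b)) mod p.
-- (Stated for p = suc m so that the NonZero instance is available.)
_-ₚ_ : ∀ {m} → Fin (suc m) → Fin (suc m) → Fin (suc m)
_-ₚ_ {m} a b = (toℕ a + (suc m ∸ toℕ b)) mod (suc m)

_-ᵥ_ : ∀ {m n} → Vec (Fin (suc m)) n → Vec (Fin (suc m)) n → Vec (Fin (suc m)) n
_-ᵥ_ = zipWith _-ₚ_

_∈ⁿ_ : ∀ {m n} → Vec (Fin (suc m)) n → Subset (suc m) → Set
v ∈ⁿ K = All (_∈ K) v

module Submission where

-- Let k₁,…,k_r be the r = p - |K| residues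
-- outside K (all nonzero, as 0 ∈ K) and, for a, b ∈ (F_p)^n, put  P_a(b) = ∏ᵢ ∏ⱼ (aᵢ - kⱼ - bᵢ).
--   * If a - b ∉ Kⁿ then some aᵢ - bᵢ equals some kⱼ, so P_a(b) ≡ 0 (mod p).
--   * P_b(b) = ∏ᵢ ∏ⱼ (-kⱼ) ≢ 0 (mod p).
--   * P_a has degree ≤ r in each variable, so P_a(b) = ⟨u(a), v(b)⟩ with u(a) the coefficients
--     and v(b) the monomials, vectors of dimension (r+1)^n.
-- If |A| > (r+1)^n, Gaussian elimination mod p gives Σ lₐ u(a) ≡ 0 with some l_b ≢ 0. Pairing
-- with v(b) yields Σ lₐ P_a(b) ≡ 0; if A had no admissible pair, this sum would be ≡ l_b P_b(b) ≢ 0.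
-- All computations are in ℤ, "≡ 0 (mod p)" being divisibility by p.

open import Data.Bool using (true; false)
open import Data.Empty using (⊥-elim)
open import Data.Fin using (Fin; zero; suc; toℕ; punchIn; punchOut; _≟_)
open import Data.Fin.Properties using (any?; punchIn-punchOut; toℕ<n; toℕ-fromℕ<)
open import Data.Fin.Subset using (Subset; _∈_; ∣_∣; ∁)
open import Data.Fin.Subset.Properties using (_∈?_; ∣∁p∣≡n∸∣p∣; x∈∁p⇒x∉p; x∉p⇒x∈∁p)
open import Data.Integer using (ℤ; +_; -_; 0ℤ; 1ℤ; _+_; _*_; _-_) renaming (∣_∣ to ∣_∣ᶻ)
open import Data.Integer.Properties
  using (+-identityˡ; +-identityʳ; +-inverseʳ; +-assoc; *-assoc; *-zeroʳ; *-distribˡ-+; *-distribʳ-+; neg-involutive; pos-*; abs-*)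
open import Data.Integer.Divisibility.Signed
  using (_∣_; divides; _∣?_; ∣ᵤ⇒∣; ∣⇒∣ᵤ; ∣-refl; ∣m∣n⇒∣m+n; ∣m∣n⇒∣m-n; ∣m⇒∣-m; ∣n⇒∣m*n; ∣m⇒∣m*n; ∣m+n∣m⇒∣n; ∣m+n∣n⇒∣m)
open import Data.Integer.Tactic.RingSolver using (solve-∀)
open import Data.List using (List; []; _∷_; length; map)
open import Data.List.Properties using (length-map; map-∘; map-id)
open import Data.List.Relation.Unary.Any using (Any; here; there) renaming (any? to anyₗ?)
import Data.List.Relation.Unary.Any as Any
open import Data.List.Relation.Unary.Any.Properties using (map⁺)
open import Data.List.Relation.Unary.All using () renaming (lookup to lookupAll)
open import Data.List.Relation.Unary.AllPairs using (_∷_)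
open import Data.List.Relation.Unary.Unique.Propositional using (Unique)
open import Data.List.Membership.Propositional using (find; lose) renaming (_∈_ to _∈ₗ_)
open import Data.List.Membership.Propositional.Properties using (∈-map⁺; ∈-map⁻)
open import Data.Nat as ℕ using (ℕ; suc; _∸_; _^_; _<_; _≥_; s≤s)
open import Data.Nat.Divisibility using (>⇒∤) renaming (_∣_ to _∣ℕ_)
open import Data.Nat.DivMod using (_%_; _/_; m%n<n; m≡m%n+[m/n]*n)
open import Data.Nat.Primality using (Prime; euclidsLemma; prime⇒nonTrivial)
import Data.Nat.Properties as ℕ
open import Data.Product using (_×_; _,_; proj₁; proj₂; map₁; ∃-syntax)
open import Data.Sum using (_⊎_; inj₁; inj₂)
open import Data.Vec using (Vec; []; _∷_; lookup; _++_)
import Data.Vec as Vec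
open import Data.Vec.Base using (here; there)
open import Data.Vec.Properties using (≡-dec)
open import Data.Vec.Relation.Unary.All using (all?; []; _∷_)
open import Function using (_∘_)
open import Relation.Binary.PropositionalEquality
open import Relation.Nullary using (¬_; Dec; yes; no)
open import Relation.Nullary.Decidable using (¬?; _×-dec_; decidable-stable)
open import Defs

⟪_,_⟫ : ∀ {D} → (Fin D → ℤ) → Vec ℤ D → ℤ
⟪ f , [] ⟫ = 0ℤ
⟪ f , x ∷ v ⟫ = f zero * x + ⟪ f ∘ suc , v ⟫

dot : ∀ {D} → Vec ℤ D → Vec ℤ D → ℤ
dot u v = ⟪ lookup u , v ⟫

pairing-zero : ∀ {D} (v : Vec ℤ D) → ⟪ (λ _ → 0ℤ) , v ⟫ ≡ 0ℤ
pairing-zero [] = refl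
pairing-zero (x ∷ v) = trans (+-identityˡ _) (pairing-zero v)

pairing-linear : ∀ {D} l (g h : Fin D → ℤ) v → ⟪ (λ k → l * g k + h k) , v ⟫ ≡ l * ⟪ g , v ⟫ + ⟪ h , v ⟫
pairing-linear l g h [] = sym (trans (+-identityʳ (l * 0ℤ)) (*-zeroʳ l))
pairing-linear l g h (x ∷ v) =
  trans (cong (_+_ ((l * g zero + h zero) * x)) (pairing-linear l (g ∘ suc) (h ∘ suc) v))
        (regroup l (g zero) (h zero) x ⟪ g ∘ suc , v ⟫ ⟪ h ∘ suc , v ⟫)
  where
  regroup : ∀ l a b x s t → (l * a + b) * x + (l * s + t) ≡ l * (a * x + s) + (b * x + t)
  regroup = solve-∀

dot-++ : ∀ {D E} (a c : Vec ℤ D) (b d : Vec ℤ E) → dot (a ++ b) (c ++ d) ≡ dot a c + dot b d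
dot-++ [] [] b d = sym (+-identityˡ (dot b d))
dot-++ (x ∷ a) (y ∷ c) b d = trans (cong (_+_ (x * y)) (dot-++ a c b d)) (sym (+-assoc (x * y) (dot a c) (dot b d)))

dot-scaleˡ : ∀ {D} x (a b : Vec ℤ D) → dot (Vec.map (x *_) a) b ≡ x * dot a b
dot-scaleˡ x [] [] = sym (*-zeroʳ x)
dot-scaleˡ x (a ∷ as) (b ∷ bs) =
  trans (cong₂ _+_ (*-assoc x a b) (dot-scaleˡ x as bs)) (sym (*-distribˡ-+ x (a * b) (dot as bs)))

dot-scaleʳ : ∀ {D} y (a b : Vec ℤ D) → dot a (Vec.map (y *_) b) ≡ y * dot a b
dot-scaleʳ y [] [] = sym (*-zeroʳ y)
dot-scaleʳ y (a ∷ as) (b ∷ bs) =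
  trans (cong (_+_ (a * (y * b))) (dot-scaleʳ y as bs)) (regroup y a b (dot as bs))
  where
  regroup : ∀ y a b s → a * (y * b) + y * s ≡ y * (a * b + s)
  regroup = solve-∀

_⊗_ : ∀ {D E} → Vec ℤ D → Vec ℤ E → Vec ℤ (D ℕ.* E)
[] ⊗ v = []
(x ∷ u) ⊗ v = Vec.map (x *_) v ++ (u ⊗ v)

dot-⊗ : ∀ {D E} (u v : Vec ℤ D) (u′ v′ : Vec ℤ E) → dot (u ⊗ u′) (v ⊗ v′) ≡ dot u v * dot u′ v′
dot-⊗ [] [] u′ v′ = refl
dot-⊗ (x ∷ u) (y ∷ v) u′ v′ = begin
  dot (Vec.map (x *_) u′ ++ u ⊗ u′) (Vec.map (y *_) v′ ++ v ⊗ v′)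
    ≡⟨ dot-++ (Vec.map (x *_) u′) (Vec.map (y *_) v′) (u ⊗ u′) (v ⊗ v′) ⟩
  dot (Vec.map (x *_) u′) (Vec.map (y *_) v′) + dot (u ⊗ u′) (v ⊗ v′)
    ≡⟨ cong₂ _+_ scaled (dot-⊗ u v u′ v′) ⟩
  x * y * dot u′ v′ + dot u v * dot u′ v′
    ≡⟨ sym (*-distribʳ-+ (dot u′ v′) (x * y) (dot u v)) ⟩
  (x * y + dot u v) * dot u′ v′ ∎
  where
  open ≡-Reasoning
  scaled : dot (Vec.map (x *_) u′) (Vec.map (y *_) v′) ≡ x * y * dot u′ v′
  scaled = trans (dot-scaleˡ x u′ (Vec.map (y *_) v′))
                 (trans (cong (x *_) (dot-scaleʳ y u′ v′)) (sym (*-assoc x y (dot u′ v′))))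

powers : ∀ D → ℤ → Vec ℤ D
powers 0 y = []
powers (suc D) y = 1ℤ ∷ Vec.map (y *_) (powers D y)

eval : ∀ {D} → Vec ℤ D → ℤ → ℤ
eval {D} v y = dot v (powers D y)

mul-linear : ∀ {D} → ℤ → ℤ → Vec ℤ D → Vec ℤ (suc D)
mul-linear x c [] = - c ∷ []
mul-linear x c (a ∷ v) = x * a - c ∷ mul-linear x a v

eval-mul-linear : ∀ {D} x c (v : Vec ℤ D) y → eval (mul-linear x c v) y ≡ (x - y) * eval v y - c
eval-mul-linear x c [] y = constant x c y
  where
  constant : ∀ x c y → (- c) * 1ℤ + 0ℤ ≡ (x - y) * 0ℤ - c
  constant = solve-∀
eval-mul-linear {suc D} x c (a ∷ v) y = begin
  (x * a - c) * 1ℤ + dot (mul-linear x a v) (Vec.map (y *_) (powers (suc D) y))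
    ≡⟨ cong (_+_ ((x * a - c) * 1ℤ)) (dot-scaleʳ y (mul-linear x a v) (powers (suc D) y)) ⟩
  (x * a - c) * 1ℤ + y * eval (mul-linear x a v) y
    ≡⟨ cong (λ e → (x * a - c) * 1ℤ + y * e) (eval-mul-linear x a v y) ⟩
  (x * a - c) * 1ℤ + y * ((x - y) * eval v y - a)
    ≡⟨ horner x a c y (eval v y) ⟩
  (x - y) * (a * 1ℤ + y * eval v y) - c
    ≡⟨ cong (λ e → (x - y) * (a * 1ℤ + e) - c) (sym (dot-scaleʳ y v (powers D y))) ⟩
  (x - y) * (a * 1ℤ + dot v (Vec.map (y *_) (powers D y))) - c ∎
  where
  open ≡-Reasoning
  horner : ∀ x a c y e → (x * a - c) * 1ℤ + y * ((x - y) * e - a) ≡ (x - y) * (a * 1ℤ + y * e) - c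
  horner = solve-∀

kernel : List ℤ → ℤ → ℤ → ℤ
kernel [] c d = 1ℤ
kernel (k ∷ ks) c d = (c - k - d) * kernel ks c d

kernel-coefficients : (ks : List ℤ) → ℤ → Vec ℤ (suc (length ks))
kernel-coefficients [] c = 1ℤ ∷ []
kernel-coefficients (k ∷ ks) c = mul-linear (c - k) 0ℤ (kernel-coefficients ks c)

eval-kernel-coefficients : ∀ ks c d → eval (kernel-coefficients ks c) d ≡ kernel ks c d
eval-kernel-coefficients [] c d = refl
eval-kernel-coefficients (k ∷ ks) c d =
  trans (eval-mul-linear (c - k) 0ℤ (kernel-coefficients ks c) d)
        (trans (+-identityʳ _) (cong ((c - k - d) *_) (eval-kernel-coefficients ks c d)))

module KernelFactorisation (ks : List ℤ) where

  r : ℕ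
  r = length ks

  kernelⁿ : ∀ {n} → Vec ℤ n → Vec ℤ n → ℤ
  kernelⁿ [] [] = 1ℤ
  kernelⁿ (c ∷ cs) (d ∷ ds) = kernel ks c d * kernelⁿ cs ds

  coefficients : ∀ {n} → Vec ℤ n → Vec ℤ (suc r ^ n)
  coefficients [] = 1ℤ ∷ []
  coefficients (c ∷ cs) = kernel-coefficients ks c ⊗ coefficients cs

  monomials : ∀ {n} → Vec ℤ n → Vec ℤ (suc r ^ n)
  monomials [] = 1ℤ ∷ []
  monomials (d ∷ ds) = powers (suc r) d ⊗ monomials ds

  factorisation : ∀ {n} (cs ds : Vec ℤ n) → dot (coefficients cs) (monomials ds) ≡ kernelⁿ cs ds
  factorisation [] [] = refl
  factorisation (c ∷ cs) (d ∷ ds) =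
    trans (dot-⊗ (kernel-coefficients ks c) (powers (suc r) d) (coefficients cs) (monomials ds))
          (cong₂ _*_ (eval-kernel-coefficients ks c d) (factorisation cs ds))

Combination : Set → Set
Combination X = List (ℤ × X)

support : ∀ {X : Set} → Combination X → List X
support = map proj₂

lincomb : ∀ {X : Set} → Combination X → (X → ℤ) → ℤ
lincomb [] f = 0ℤ
lincomb ((l , x) ∷ Z) f = l * f x + lincomb Z f

lincomb-scale : ∀ {X : Set} w (Z : Combination X) f → lincomb (map (map₁ (w *_)) Z) f ≡ w * lincomb Z f
lincomb-scale w [] f = sym (*-zeroʳ w)
lincomb-scale w ((l , x) ∷ Z) f =
  trans (cong₂ _+_ (*-assoc w l (f x)) (lincomb-scale w Z f)) (sym (*-distribˡ-+ w (l * f x) (lincomb Z f)))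

lincomb-linear : ∀ {X : Set} a b (Z : Combination X) f g →
  lincomb Z (λ x → a * f x - b * g x) ≡ a * lincomb Z f - b * lincomb Z g
lincomb-linear a b [] f g = empty a b
  where
  empty : ∀ a b → 0ℤ ≡ a * 0ℤ - b * 0ℤ
  empty = solve-∀
lincomb-linear a b ((l , x) ∷ Z) f g =
  trans (cong (_+_ (l * (a * f x - b * g x))) (lincomb-linear a b Z f g))
        (regroup a b l (f x) (g x) (lincomb Z f) (lincomb Z g))
  where
  regroup : ∀ a b l u v s t → l * (a * u - b * v) + (a * s - b * t) ≡ a * (l * u + s) - b * (l * v + t)
  regroup = solve-∀

lincomb-pairing : ∀ {X : Set} {D} (Z : Combination X) (U : X → Fin D → ℤ) v →
  lincomb Z (λ x → ⟪ U x , v ⟫) ≡ ⟪ (λ k → lincomb Z (λ x → U x k)) , v ⟫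
lincomb-pairing [] U v = sym (pairing-zero v)
lincomb-pairing ((l , x) ∷ Z) U v =
  trans (cong (_+_ (l * ⟪ U x , v ⟫)) (lincomb-pairing Z U v))
        (sym (pairing-linear l (U x) (λ k → lincomb Z (λ y → U y k)) v))

support-zeros : ∀ {X : Set} (xs : List X) → support (map (0ℤ ,_) xs) ≡ xs
support-zeros xs = trans (sym (map-∘ xs)) (map-id xs)

module Modular (p : ℕ) (p-prime : Prime p) where

  Vanishes : ℤ → Set
  Vanishes z = + p ∣ z

  vanishes? : ∀ z → Dec (Vanishes z)
  vanishes? z = + p ∣? z

  0-vanishes : Vanishes 0ℤ
  0-vanishes = divides 0ℤ refl

  1-nonvanishing : ¬ Vanishes 1ℤ
  1-nonvanishing p∣1 = >⇒∤ (ℕ.nonTrivial⇒n>1 p {{prime⇒nonTrivial p-prime}}) (∣⇒∣ᵤ p∣1)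

  *-nonvanishing : ∀ {x y} → ¬ Vanishes x → ¬ Vanishes y → ¬ Vanishes (x * y)
  *-nonvanishing {x} {y} x≢0 y≢0 p∣xy
    with euclidsLemma ∣ x ∣ᶻ ∣ y ∣ᶻ p-prime (subst (p ∣ℕ_) (abs-* x y) (∣⇒∣ᵤ p∣xy))
  ... | inj₁ p∣x = x≢0 (∣ᵤ⇒∣ p∣x)
  ... | inj₂ p∣y = y≢0 (∣ᵤ⇒∣ p∣y)

  +-nonvanishingˡ : ∀ {x y} → ¬ Vanishes x → Vanishes y → ¬ Vanishes (x + y)
  +-nonvanishingˡ x≢0 p∣y p∣x+y = x≢0 (∣m+n∣n⇒∣m p∣x+y p∣y)

  +-nonvanishingʳ : ∀ {x y} → Vanishes x → ¬ Vanishes y → ¬ Vanishes (x + y)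
  +-nonvanishingʳ p∣x y≢0 p∣x+y = y≢0 (∣m+n∣m⇒∣n p∣x+y p∣x)

  nonzero-residue : ∀ k .{{_ : ℕ.NonZero k}} → k < p → ¬ Vanishes (+ k)
  nonzero-residue k k<p p∣k = >⇒∤ k<p (∣⇒∣ᵤ p∣k)

  kernel-root : ∀ {k} ks c d → k ∈ₗ ks → Vanishes (c - k - d) → Vanishes (kernel ks c d)
  kernel-root (k ∷ ks) c d (here refl) p∣factor = ∣m⇒∣m*n (kernel ks c d) p∣factor
  kernel-root (k′ ∷ ks) c d (there k∈ks) p∣factor = ∣n⇒∣m*n (c - k′ - d) (kernel-root ks c d k∈ks p∣factor)

  kernel-diagonal : ∀ ks c → (∀ {k} → k ∈ₗ ks → ¬ Vanishes k) → ¬ Vanishes (kernel ks c c)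
  kernel-diagonal [] c _ = 1-nonvanishing
  kernel-diagonal (k ∷ ks) c ks≢0 =
    *-nonvanishing factor≢0 (kernel-diagonal ks c (ks≢0 ∘ there))
    where
    diagonal-factor : ∀ c k → c - k - c ≡ - k
    diagonal-factor = solve-∀
    factor≢0 : ¬ Vanishes (c - k - c)
    factor≢0 p∣factor =
      ks≢0 (here refl) (subst Vanishes (neg-involutive k) (∣m⇒∣-m (subst Vanishes (diagonal-factor c k) p∣factor)))

  pairing-vanishes : ∀ {D} (f : Fin D → ℤ) v → (∀ k → Vanishes (f k)) → Vanishes ⟪ f , v ⟫
  pairing-vanishes f [] _ = 0-vanishes
  pairing-vanishes f (x ∷ v) f≡0 = ∣m∣n⇒∣m+n (∣m⇒∣m*n x (f≡0 zero)) (pairing-vanishes (f ∘ suc) v (f≡0 ∘ suc))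

  lincomb-vanishes : ∀ {X : Set} (Z : Combination X) f → (∀ {x} → x ∈ₗ support Z → Vanishes (f x)) →
    Vanishes (lincomb Z f)
  lincomb-vanishes [] f _ = 0-vanishes
  lincomb-vanishes ((l , x) ∷ Z) f f≡0 = ∣m∣n⇒∣m+n (∣n⇒∣m*n l (f≡0 (here refl))) (lincomb-vanishes Z f (f≡0 ∘ there))

  zeros-vanish : ∀ {X : Set} (xs : List X) f → Vanishes (lincomb (map (0ℤ ,_) xs) f)
  zeros-vanish [] f = 0-vanishes
  zeros-vanish (x ∷ xs) f = ∣m∣n⇒∣m+n 0-vanishes (zeros-vanish xs f)

  -- Isolated term: if every x ≠ b in the support has f(x) ≡ 0, but f(b) ≢ 0 and b carries a
  -- coefficient l ≢ 0, then Σ l·f(x) ≢ 0. Uniqueness of the support makes b occur only once.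
  isolated-term : ∀ {X : Set} (f : X → ℤ) {l b} (Z : Combination X) → Unique (support Z) →
    (l , b) ∈ₗ Z → ¬ Vanishes l → (∀ {x} → x ∈ₗ support Z → x ≢ b → Vanishes (f x)) → ¬ Vanishes (f b) →
    ¬ Vanishes (lincomb Z f)
  isolated-term f (_ ∷ Z) (b∉Z ∷ _) (here refl) l≢0 off fb≢0 =
    +-nonvanishingˡ (*-nonvanishing l≢0 fb≢0)
      (lincomb-vanishes Z f (λ x∈Z → off (there x∈Z) (λ x≡b → lookupAll b∉Z x∈Z (sym x≡b))))
  isolated-term f ((l′ , x) ∷ Z) (x∉Z ∷ unique) (there lb∈Z) l≢0 off fb≢0 =
    +-nonvanishingʳ (∣n⇒∣m*n l′ (off (here refl) (lookupAll x∉Z (∈-map⁺ proj₂ lb∈Z))))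
      (isolated-term f Z unique lb∈Z l≢0 (off ∘ there) fb≢0)

  record Dependence {X : Set} {D : ℕ} (U : X → Fin D → ℤ) (xs : List X) : Set where
    field
      terms : Combination X
      support-≡ : support terms ≡ xs
      nontrivial : Any (λ t → ¬ Vanishes (proj₁ t)) terms
      vanishing : ∀ k → Vanishes (lincomb terms (λ x → U x k))

  trivial-dependence : ∀ {X : Set} {D} (U : X → Fin D → ℤ) x xs → (∀ k → Vanishes (U x k)) →
    Dependence U (x ∷ xs)
  trivial-dependence U x xs Ux≡0 = record
    { terms = (1ℤ , x) ∷ map (0ℤ ,_) xs
    ; support-≡ = cong (x ∷_) (support-zeros xs)
    ; nontrivial = here 1-nonvanishing
    ; vanishing = λ k → ∣m∣n⇒∣m+n (∣n⇒∣m*n 1ℤ (Ux≡0 k)) (zeros-vanish xs (λ y → U y k))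
    }

  -- Gaussian elimination step: clear coordinate j of every vector against the pivot U x₀,
  --   cleared x k = U x₀ j · U x k - U x₀ k · U x j,
  -- which kills coordinate j; the reduced family drops that coordinate.
  cleared : ∀ {X : Set} {D} → (X → Fin D → ℤ) → X → Fin D → X → Fin D → ℤ
  cleared U x₀ j x k = U x₀ j * U x k - U x₀ k * U x j

  reduced : ∀ {X : Set} {D} → (X → Fin (suc D) → ℤ) → X → Fin (suc D) → X → Fin D → ℤ
  reduced U x₀ j x = cleared U x₀ j x ∘ punchIn j

  lift-dependence : ∀ {X : Set} {D} (U : X → Fin (suc D) → ℤ) x₀ xs j → ¬ Vanishes (U x₀ j) →
    Dependence (reduced U x₀ j) xs → Dependence U (x₀ ∷ xs)
  lift-dependence {D = D} U x₀ xs j pivot dep = record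
    { terms = (- L j , x₀) ∷ map (map₁ (w *_)) terms
    ; support-≡ = cong (x₀ ∷_) (trans (sym (map-∘ terms)) support-≡)
    ; nontrivial = there (map⁺ (Any.map (*-nonvanishing pivot) nontrivial))
    ; vanishing = vanishing′
    }
    where
    open Dependence dep
    w : ℤ
    w = U x₀ j
    L : Fin (suc D) → ℤ
    L k = lincomb terms (λ x → U x k)
    -- Coordinate k of the lifted combination is w·L k - U x₀ k·L j = Σ l·cleared x k.
    combined : ∀ k → (- L j) * U x₀ k + lincomb (map (map₁ (w *_)) terms) (λ x → U x k) ≡ w * L k - U x₀ k * L j
    combined k = trans (cong (_+_ ((- L j) * U x₀ k)) (lincomb-scale w terms (λ x → U x k))) (reorder (L j) (U x₀ k) w (L k))
      where
      reorder : ∀ t u w s → (- t) * u + w * s ≡ w * s - u * t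
      reorder = solve-∀
    vanishing′ : ∀ k → Vanishes ((- L j) * U x₀ k + lincomb (map (map₁ (w *_)) terms) (λ x → U x k))
    vanishing′ k with j ≟ k
    ... | yes refl = subst Vanishes (sym (trans (combined j) (+-inverseʳ (w * L j)))) 0-vanishes
    ... | no j≢k = subst Vanishes (sym (trans (combined k) (sym (lincomb-linear w (U x₀ k) terms _ _)))) cleared-k
      where
      cleared-k : Vanishes (lincomb terms (λ x → cleared U x₀ j x k))
      cleared-k = subst (λ i → Vanishes (lincomb terms (λ x → cleared U x₀ j x i)))
                        (punchIn-punchOut j≢k) (vanishing (punchOut j≢k))

  dependence : ∀ {X : Set} {D} (U : X → Fin D → ℤ) (xs : List X) → D < length xs → Dependence U xs
  dependence {D = 0} U (x ∷ xs) _ = trivial-dependence U x xs (λ ())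
  dependence {D = suc D} U (x ∷ xs) (s≤s D<xs) with any? (λ k → ¬? (vanishes? (U x k)))
  ... | yes (j , pivot) = lift-dependence U x xs j pivot (dependence (reduced U x j) xs D<xs)
  ... | no no-pivot = trivial-dependence U x xs (λ k → decidable-stable (vanishes? (U x k)) (λ k≢0 → no-pivot (k , k≢0)))

elements : ∀ {n} → Subset n → List (Fin n)
elements [] = []
elements (true ∷ s) = zero ∷ map suc (elements s)
elements (false ∷ s) = map suc (elements s)

length-elements : ∀ {n} (s : Subset n) → length (elements s) ≡ ∣ s ∣
length-elements [] = refl
length-elements (true ∷ s) = cong suc (trans (length-map suc (elements s)) (length-elements s))
length-elements (false ∷ s) = trans (length-map suc (elements s)) (length-elements s)

elements-complete : ∀ {n} {x : Fin n} {s} → x ∈ s → x ∈ₗ elements s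
elements-complete {s = true ∷ s} here = here refl
elements-complete {s = true ∷ s} (there x∈s) = there (∈-map⁺ suc (elements-complete x∈s))
elements-complete {s = false ∷ s} (there x∈s) = ∈-map⁺ suc (elements-complete x∈s)

elements-sound : ∀ {n} {x : Fin n} s → x ∈ₗ elements s → x ∈ s
elements-sound (true ∷ s) (here refl) = here
elements-sound (true ∷ s) (there x∈) with ∈-map⁻ suc x∈
... | y , y∈ , refl = there (elements-sound s y∈)
elements-sound (false ∷ s) x∈ with ∈-map⁻ suc x∈
... | y , y∈ , refl = there (elements-sound s y∈)

shift-lemma : ∀ c e d P Q → c + P ≡ e + Q + d → c - e - d ≡ Q - P
shift-lemma c e d P Q eq = begin
  c - e - d                 ≡⟨ add-and-subtract c e d P ⟩
  (c + P) - e - d - P       ≡⟨ cong (λ s → s - e - d - P) eq ⟩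
  (e + Q + d) - e - d - P   ≡⟨ cancel e Q d P ⟩
  Q - P ∎
  where
  open ≡-Reasoning
  add-and-subtract : ∀ c e d P → c - e - d ≡ (c + P) - e - d - P
  add-and-subtract = solve-∀
  cancel : ∀ e Q d P → (e + Q + d) - e - d - P ≡ Q - P
  cancel = solve-∀

module FiniteField (m : ℕ) (p-prime : Prime (suc m)) (K : Subset (suc m)) (0∈K : zero ∈ K) where

  p : ℕ
  p = suc m

  open Modular p p-prime

  toℤ : Fin p → ℤ
  toℤ k = + toℕ k

  excluded : List ℤ
  excluded = map toℤ (elements (∁ K))

  open KernelFactorisation excluded

  degree : p ∸ ∣ K ∣ ℕ.+ 1 ≡ suc r
  degree = begin
    p ∸ ∣ K ∣ ℕ.+ 1                ≡⟨ ℕ.+-comm (p ∸ ∣ K ∣) 1 ⟩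
    suc (p ∸ ∣ K ∣)                 ≡⟨ cong suc (sym (∣∁p∣≡n∸∣p∣ K)) ⟩
    suc ∣ ∁ K ∣                     ≡⟨ cong suc (sym (length-elements (∁ K))) ⟩
    suc (length (elements (∁ K)))   ≡⟨ cong suc (sym (length-map toℤ (elements (∁ K)))) ⟩
    suc r ∎
    where open ≡-Reasoning

  -ₚ-represents : ∀ c d → Vanishes (toℤ c - toℤ (c -ₚ d) - toℤ d)
  -ₚ-represents c d =
    subst Vanishes (sym shift) (∣m∣n⇒∣m-n (divides (+ (x / p)) (pos-* (x / p) p)) ∣-refl)
    where
    open ≡-Reasoning
    x : ℕ
    x = toℕ c ℕ.+ (p ∸ toℕ d)
    representative : toℕ (c -ₚ d) ≡ x % p
    representative = toℕ-fromℕ< (m%n<n x p)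
    division : toℕ c ℕ.+ p ≡ x % p ℕ.+ x / p ℕ.* p ℕ.+ toℕ d
    division = begin
      toℕ c ℕ.+ p                         ≡⟨ cong (toℕ c ℕ.+_) (sym (ℕ.m∸n+n≡m (ℕ.<⇒≤ (toℕ<n d)))) ⟩
      toℕ c ℕ.+ (p ∸ toℕ d ℕ.+ toℕ d)     ≡⟨ sym (ℕ.+-assoc (toℕ c) (p ∸ toℕ d) (toℕ d)) ⟩
      x ℕ.+ toℕ d                         ≡⟨ cong (ℕ._+ toℕ d) (m≡m%n+[m/n]*n x p) ⟩
      x % p ℕ.+ x / p ℕ.* p ℕ.+ toℕ d ∎
    shift : toℤ c - toℤ (c -ₚ d) - toℤ d ≡ + (x / p ℕ.* p) - + p
    shift = trans (cong (λ e → toℤ c - + e - toℤ d) representative)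
                  (shift-lemma (toℤ c) (+ (x % p)) (toℤ d) (+ p) (+ (x / p ℕ.* p)) (cong +_ division))

  excluded-nonvanishing : ∀ {k} → k ∈ₗ excluded → ¬ Vanishes k
  excluded-nonvanishing k∈ with ∈-map⁻ toℤ k∈
  ... | zero , 0∈∁K , refl = ⊥-elim (x∈∁p⇒x∉p (elements-sound (∁ K) 0∈∁K) 0∈K)
  ... | suc k , _ , refl = nonzero-residue (toℕ (suc k)) (toℕ<n (suc k))

  toℤᵛ : ∀ {n} → Vec (Fin p) n → Vec ℤ n
  toℤᵛ = Vec.map toℤ

  kernel-off-diagonal : ∀ {n} (a b : Vec (Fin p) n) → ¬ ((a -ᵥ b) ∈ⁿ K) → Vanishes (kernelⁿ (toℤᵛ a) (toℤᵛ b))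
  kernel-off-diagonal [] [] not-in = ⊥-elim (not-in [])
  kernel-off-diagonal (c ∷ a) (d ∷ b) not-in with (c -ₚ d) ∈? K
  ... | yes c-d∈K = ∣n⇒∣m*n (kernel excluded (toℤ c) (toℤ d)) (kernel-off-diagonal a b (λ rest → not-in (c-d∈K ∷ rest)))
  ... | no c-d∉K = ∣m⇒∣m*n (kernelⁿ (toℤᵛ a) (toℤᵛ b))
        (kernel-root excluded (toℤ c) (toℤ d) (∈-map⁺ toℤ (elements-complete (x∉p⇒x∈∁p c-d∉K))) (-ₚ-represents c d))

  kernelⁿ-diagonal : ∀ {n} (b : Vec (Fin p) n) → ¬ Vanishes (kernelⁿ (toℤᵛ b) (toℤᵛ b))
  kernelⁿ-diagonal [] = 1-nonvanishing
  kernelⁿ-diagonal (c ∷ b) = *-nonvanishing (kernel-diagonal excluded (toℤ c) excluded-nonvanishing) (kernelⁿ-diagonal b)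

  DifferenceFree : ∀ {n} → List (Vec (Fin p) n) → Set
  DifferenceFree A = ∀ {a b} → a ∈ₗ A → b ∈ₗ A → ¬ (a ≢ b × (a -ᵥ b) ∈ⁿ K)

  row : ∀ {n} → Vec (Fin p) n → Fin (suc r ^ n) → ℤ
  row a = lookup (coefficients (toℤᵛ a))

  difference-free-bound : ∀ {n} (A : List (Vec (Fin p) n)) → Unique A → DifferenceFree A → ¬ (suc r ^ n < length A)
  difference-free-bound {n} A unique-A free large with dependence row A large
  ... | dep with find (Dependence.nontrivial dep)
  ... | (l , b) , lb∈terms , l≢0 =
    isolated-term value terms unique-terms lb∈terms l≢0 off-diagonal diagonal sum-vanishes
    where
    open Dependence dep
    value : Vec (Fin p) n → ℤ
    value a = ⟪ row a , monomials (toℤᵛ b) ⟫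
    unique-terms : Unique (support terms)
    unique-terms = subst Unique (sym support-≡) unique-A
    in-A : ∀ {a} → a ∈ₗ support terms → a ∈ₗ A
    in-A = subst (_ ∈ₗ_) support-≡
    off-diagonal : ∀ {a} → a ∈ₗ support terms → a ≢ b → Vanishes (value a)
    off-diagonal {a} a∈ a≢b = subst Vanishes (sym (factorisation (toℤᵛ a) (toℤᵛ b)))
      (kernel-off-diagonal a b (λ diff → free (in-A a∈) (in-A (∈-map⁺ proj₂ lb∈terms)) (a≢b , diff)))
    diagonal : ¬ Vanishes (value b)
    diagonal = kernelⁿ-diagonal b ∘ subst Vanishes (factorisation (toℤᵛ b) (toℤᵛ b))
    sum-vanishes : Vanishes (lincomb terms value)
    sum-vanishes = subst Vanishes (sym (lincomb-pairing terms row (monomials (toℤᵛ b))))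
      (pairing-vanishes _ (monomials (toℤᵛ b)) vanishing)

pair-search : ∀ {X : Set} {R : X → X → Set} → (∀ a b → Dec (R a b)) → (A : List X) →
  (∃[ a₁ ] ∃[ a₂ ] (a₁ ∈ₗ A × a₂ ∈ₗ A × R a₁ a₂)) ⊎ (∀ {a₁ a₂} → a₁ ∈ₗ A → a₂ ∈ₗ A → ¬ R a₁ a₂)
pair-search R? A with anyₗ? (λ a₁ → anyₗ? (R? a₁) A) A
... | no none = inj₂ λ a₁∈ a₂∈ r → none (lose a₁∈ (lose a₂∈ r))
... | yes found with find found
... | a₁ , a₁∈ , found₂ with find found₂
... | a₂ , a₂∈ , r = inj₁ (a₁ , a₂ , a₁∈ , a₂∈ , r)

theorem1p2 : (m : ℕ) → Prime (suc m) → suc m ≥ 3 → (n : ℕ) → n ≥ 1 →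
    (K : Subset (suc m)) → zero ∈ K →
    (A : List (Vec (Fin (suc m)) n)) → Unique A →
    (suc m ∸ ∣ K ∣ ℕ.+ 1) ^ n < length A →
    ∃[ a₁ ] ∃[ a₂ ] (a₁ ∈ₗ A × a₂ ∈ₗ A × a₁ ≢ a₂ × (a₁ -ᵥ a₂) ∈ⁿ K)
theorem1p2 m p-prime _ n _ K 0∈K A unique-A large
  with pair-search (λ a b → ¬? (≡-dec _≟_ a b) ×-dec all? (_∈? K) (a -ᵥ b)) A
... | inj₁ pair = pair
... | inj₂ free =
  ⊥-elim (difference-free-bound A unique-A free (subst (λ D → D ^ n < length A) degree large))
  where open FiniteField m p-prime K 0∈K
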